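{- For every nonnegative integer $k$, $\mathcal{A}^{(k)}$ is a Hopf subalgebra of $\mathcal{A}$, and the linear map $\phi_k:\mathcal{A}\to\mathcal{A}^{(k)}$ defined on simplicial complexes by $\phi_k(\Gamma)=\Gamma^{(k)}$ is a Hopf algebra homomorphism.
   Context: A finite simplicial complex $\Gamma$ is a collection of subsets (faces) of a finite set closed under taking subsets; $\dim X=|X|-1$, $\dim\Gamma$ is the maximal face dimension, $V(\Gamma)$ the set of vertices. For $T\subseteq V(\Gamma)$, $\Gamma_T=\{X\cap T:X\in\Gamma\}$. $\mathcal{A}=\bigoplus_{n\ge0}A_n$ over a field $\mathbb{K}$, $A_n$ spanned by isomorphism classes of simplicial complexes on $n$ vertices; product is disjoint union, unit the empty complex $\varnothing$, coproduct $\Delta(\Gamma)=\sum_{T\subseteq V(\Gamma)}\Gamma_T\otimes\Gamma_{V(\Gamma)-T}$, counit $\epsilon(\Gamma)=\delta_{\Gamma,\varnothing}$. The $k$-skeleton $\Gamma^{(k)}$ is the set of faces of $\Gamma$ of dimension at most $k$. $\mathcal{A}^{(k)}$ is the $\mathbb{K}$-span of (isomorphism classes of) simplicial complexes of dimension at most $k$. -}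

module Defs where

open import Level using (Level; _⊔_) renaming (suc to lsuc; zero to lzero)
open import Data.Bool using (Bool; true; false; not)
open import Data.Nat using (ℕ; zero; suc; _+_; _≤_; z≤n; s≤s)
open import Data.Nat.Properties using (≤-trans; m≤n⇒m≤1+n)
open import Data.Fin using (Fin; zero; suc; _↑ˡ_; _↑ʳ_)
open import Data.Product using (Σ; _×_; _,_; proj₁; proj₂)
open import Data.Sum using (_⊎_; inj₁; inj₂)
open import Data.Unit using (⊤; tt)
open import Data.Empty using (⊥)
open import Data.List using (List; []; _∷_; map; concatMap; foldr)
open import Data.List.Relation.Unary.All using (All)
open import Relation.Nullary using (¬_)
open import Relation.Binary.PropositionalEquality using (_≡_; refl; sym; trans; cong)
open import Algebra.Bundles using (CommutativeRing)
open import Function.Base using (_∘_)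
open import Function.Bundles using (_↔_; Inverse)

record Field (c ℓ : Level) : Set (lsuc (c ⊔ ℓ)) where
  field
    commutativeRing : CommutativeRing c ℓ
  open CommutativeRing commutativeRing
  field
    0≉1 : ¬ (0# ≈ 1#)
    inverse : ∀ x → ¬ (x ≈ 0#) → Σ Carrier λ y → x * y ≈ 1#

Subset : ℕ → Set
Subset n = Fin n → Bool

_⊆_ : ∀ {n} → Subset n → Subset n → Set
Y ⊆ X = ∀ i → Y i ≡ true → X i ≡ true

∅ˢ : ∀ {n} → Subset n
∅ˢ _ = false

⁅_⁆ : ∀ {n} → Fin n → Subset n
⁅ zero ⁆ zero = true
⁅ zero ⁆ (suc j) = false
⁅ suc i ⁆ zero = false
⁅ suc i ⁆ (suc j) = ⁅ i ⁆ j

∁ : ∀ {n} → Subset n → Subset n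
∁ T = not ∘ T

IsEmpty : ∀ {n} → Subset n → Set
IsEmpty X = ∀ i → X i ≡ false

add : Bool → ℕ → ℕ
add true m = suc m
add false m = m

∣_∣ : ∀ {n} → Subset n → ℕ
∣_∣ {zero} X = 0
∣_∣ {suc n} X = add (X zero) ∣ X ∘ suc ∣

embStep : ∀ {m n} (b : Bool) → (Fin m → Fin n) → Fin (add b m) → Fin (suc n)
embStep true e zero = zero
embStep true e (suc i) = suc (e i)
embStep false e i = suc (e i)

emb : ∀ {n} (T : Subset n) → Fin ∣ T ∣ → Fin n
emb {suc n} T = embStep (T zero) (emb (T ∘ suc))

cons : ∀ {n} → Bool → Subset n → Subset (suc n)
cons b X zero = b
cons b X (suc i) = X i

allSubsets : ∀ n → List (Subset n)
allSubsets zero = (λ ()) ∷ []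
allSubsets (suc n) = concatMap (λ X → cons false X ∷ cons true X ∷ []) (allSubsets n)

record Complex (n : ℕ) : Set₁ where
  field
    Face : Subset n → Set
    down : ∀ {X Y} → Y ⊆ X → Face X → Face Y
    ∅∈   : Face ∅ˢ
    vert : ∀ i → Face ⁅ i ⁆
open Complex public

Cx : Set₁
Cx = Σ ℕ Complex

-- isomorphism of simplicial complexes: a bijection of vertex sets
-- mapping faces exactly onto faces (σ(X) = X ∘ σ⁻¹)
_≅_ : Cx → Cx → Set
(m , Γ) ≅ (n , Δ) = Σ (Fin m ↔ Fin n) λ σ →
  ∀ X → (Face Γ X → Face Δ (X ∘ Inverse.from σ)) × (Face Δ (X ∘ Inverse.from σ) → Face Γ X)

-- dim Γ ≤ k : every face has at most k+1 elements
DimLE : ℕ → Cx → Set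
DimLE k (n , Γ) = ∀ X → Face Γ X → ∣ X ∣ ≤ suc k

∣∅∣ : ∀ {n} (X : Subset n) → IsEmpty X → ∣ X ∣ ≤ 0
∣∅∣ {zero} X e = z≤n
∣∅∣ {suc n} X e with X zero | e zero
... | false | _ = ∣∅∣ (X ∘ suc) (e ∘ suc)

∣∣-mono : ∀ {n} {X Y : Subset n} → Y ⊆ X → ∣ Y ∣ ≤ ∣ X ∣
∣∣-mono {zero} s = z≤n
∣∣-mono {suc n} {X} {Y} s with Y zero in eY | X zero in eX
... | true  | true  = s≤s (∣∣-mono (λ i → s (suc i)))
... | true  | false with () ← trans (sym eX) (s zero eY)
... | false | true  = m≤n⇒m≤1+n (∣∣-mono (λ i → s (suc i)))
... | false | false = ∣∣-mono (λ i → s (suc i))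

∣⁅⁆∣ : ∀ {n} (i : Fin n) → ∣ ⁅ i ⁆ ∣ ≤ 1
∣⁅⁆∣ {suc n} zero = s≤s (∣∅∣ {n} (⁅ zero ⁆ ∘ suc) (λ _ → refl))
∣⁅⁆∣ {suc n} (suc i) = ∣⁅⁆∣ i

⁅⁆-refl : ∀ {n} (i : Fin n) → ⁅ i ⁆ i ≡ true
⁅⁆-refl zero = refl
⁅⁆-refl (suc i) = ⁅⁆-refl i

⁅⁆-eq : ∀ {n} (i j : Fin n) → ⁅ i ⁆ j ≡ true → i ≡ j
⁅⁆-eq zero zero _ = refl
⁅⁆-eq (suc i) (suc j) e = cong suc (⁅⁆-eq i j e)

≡⇒⊆ : ∀ {n} {X Y : Subset n} → (∀ i → Y i ≡ X i) → Y ⊆ X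
≡⇒⊆ p i e = trans (sym (p i)) e

false⇒⊆∅ : ∀ {n} {Y : Subset n} → IsEmpty Y → Y ⊆ ∅ˢ
false⇒⊆∅ p i e = trans (sym (p i)) e

empty-down : ∀ {n} {X Y : Subset n} → Y ⊆ X → IsEmpty X → IsEmpty Y
empty-down {X = X} {Y} s e i with Y i in eY
... | false = refl
... | true with () ← trans (sym (e i)) (s i eY)

split : ∀ m n (i : Fin (m + n)) →
        (Σ (Fin m) λ j → j ↑ˡ n ≡ i) ⊎ (Σ (Fin n) λ j → m ↑ʳ j ≡ i)
split zero n i = inj₂ (i , refl)
split (suc m) n zero = inj₁ (zero , refl)
split (suc m) n (suc i) with split m n i
... | inj₁ (j , p) = inj₁ (suc j , cong suc p)
... | inj₂ (j , p) = inj₂ (j , cong suc p)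

ll : ∀ m n (j i : Fin m) → ⁅ j ↑ˡ n ⁆ (i ↑ˡ n) ≡ ⁅ j ⁆ i
ll (suc m) n zero zero = refl
ll (suc m) n zero (suc i) = refl
ll (suc m) n (suc j) zero = refl
ll (suc m) n (suc j) (suc i) = ll m n j i

lr : ∀ m n (j : Fin m) (i : Fin n) → ⁅ j ↑ˡ n ⁆ (m ↑ʳ i) ≡ false
lr (suc m) n zero i = refl
lr (suc m) n (suc j) i = lr m n j i

rl : ∀ m n (j : Fin n) (i : Fin m) → ⁅ m ↑ʳ j ⁆ (i ↑ˡ n) ≡ false
rl (suc m) n j zero = refl
rl (suc m) n j (suc i) = rl m n j i

rr : ∀ m n (j i : Fin n) → ⁅ m ↑ʳ j ⁆ (m ↑ʳ i) ≡ ⁅ j ⁆ i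
rr zero n j i = refl
rr (suc m) n j i = rr m n j i

-- the empty complex ∅ (on 0 vertices; its only face is the empty face)
𝟘 : Complex 0
𝟘 = record { Face = λ _ → ⊤ ; down = λ _ _ → tt ; ∅∈ = tt ; vert = λ () }

skeleton : ∀ {n} → ℕ → Complex n → Complex n
skeleton {n} k Γ = record
  { Face = λ X → Face Γ X × ∣ X ∣ ≤ suc k
  ; down = λ s (f , b) → down Γ s f , ≤-trans (∣∣-mono s) b
  ; ∅∈   = ∅∈ Γ , ≤-trans (∣∅∣ {n} ∅ˢ (λ _ → refl)) z≤n
  ; vert = λ i → vert Γ i , ≤-trans (∣⁅⁆∣ i) (s≤s z≤n)
  }

-- disjoint union Γ ⊔ Δ on vertex set Fin m ⊎ Fin n ≅ Fin (m + n)
union : ∀ {m n} → Complex m → Complex n → Complex (m + n)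
union {m} {n} Γ Δ = record
  { Face = λ X → Face Γ (L X) × Face Δ (R X) × (IsEmpty (L X) ⊎ IsEmpty (R X))
  ; down = λ s (f , g , e) → down Γ (λ i → s (i ↑ˡ n)) f , down Δ (λ i → s (m ↑ʳ i)) g ,
           ed s e
  ; ∅∈ = ∅∈ Γ , ∅∈ Δ , inj₁ (λ _ → refl)
  ; vert = vt
  }
  where
  L : Subset (m + n) → Subset m
  L X i = X (i ↑ˡ n)
  R : Subset (m + n) → Subset n
  R X i = X (m ↑ʳ i)
  ed : ∀ {X Y} → Y ⊆ X → IsEmpty (L X) ⊎ IsEmpty (R X) → IsEmpty (L Y) ⊎ IsEmpty (R Y)
  ed s (inj₁ e) = inj₁ (empty-down (λ i → s (i ↑ˡ n)) e)
  ed s (inj₂ e) = inj₂ (empty-down (λ i → s (m ↑ʳ i)) e)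
  vt : ∀ i → Face Γ (L ⁅ i ⁆) × Face Δ (R ⁅ i ⁆) × (IsEmpty (L ⁅ i ⁆) ⊎ IsEmpty (R ⁅ i ⁆))
  vt i with split m n i
  ... | inj₁ (j , refl) = down Γ (≡⇒⊆ (ll m n j)) (vert Γ j) ,
                          down Δ (false⇒⊆∅ (lr m n j)) (∅∈ Δ) , inj₂ (lr m n j)
  ... | inj₂ (j , refl) = down Γ (false⇒⊆∅ (rl m n j)) (∅∈ Γ) ,
                          down Δ (≡⇒⊆ (rr m n j)) (vert Δ j) , inj₁ (rl m n j)

-- restriction Γ_T = { X ∩ T : X ∈ Γ }, relabelled onto Fin ∣ T ∣ via emb T.
-- (Y is a face iff Y ⊆ X ∩ T for some face X; as Γ_T is downward closed
-- this is the same family.)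
restrict : ∀ {n} → Complex n → (T : Subset n) → Complex ∣ T ∣
restrict {n} Γ T = record
  { Face = λ Y → Σ (Subset n) λ X → Face Γ X × (∀ i → Y i ≡ true → X (emb T i) ≡ true)
  ; down = λ s (X , f , p) → X , f , (λ i e → p i (s i e))
  ; ∅∈ = ∅ˢ , ∅∈ Γ , (λ i ())
  ; vert = λ i → ⁅ emb T i ⁆ , vert Γ (emb T i) ,
                 (λ j e → helper i j (⁅⁆-eq i j e))
  }
  where
  helper : ∀ i j → i ≡ j → ⁅ emb T i ⁆ (emb T j) ≡ true
  helper i .i refl = ⁅⁆-refl (emb T i)

_⊔ᶜ_ : Cx → Cx → Cx
(m , Γ) ⊔ᶜ (n , Δ) = (m + n , union Γ Δ)

𝟙ᶜ : Cx
𝟙ᶜ = (0 , 𝟘)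

skelᶜ : ℕ → Cx → Cx
skelᶜ k (n , Γ) = (n , skeleton k Γ)

Δᶜ : Cx → List (Cx × Cx)
Δᶜ (n , Γ) = map (λ T → (∣ T ∣ , restrict Γ T) , (∣ ∁ T ∣ , restrict Γ (∁ T))) (allSubsets n)

-- An element of 𝒜 is represented by a formal linear combination
-- (list of coefficient/complex pairs); two representatives are equal in 𝒜
-- iff every isomorphism-invariant K-valued function on complexes has the
-- same linear extension on them (i.e. equal coefficients on every
-- isomorphism class). Likewise for 𝒜 ⊗ 𝒜 with basis pairs of classes.

module Space {c ℓ : Level} (K : Field c ℓ) where
  open Field K public
  open CommutativeRing commutativeRing public renaming (_+_ to _+ₖ_)

  V : Set (lsuc lzero ⊔ c)
  V = List (Carrier × Cx)

  V⊗ : Set (lsuc lzero ⊔ c)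
  V⊗ = List (Carrier × Cx × Cx)

  eval : (Cx → Carrier) → V → Carrier
  eval f = foldr (λ t acc → proj₁ t * f (proj₂ t) +ₖ acc) 0#

  eval⊗ : (Cx → Cx → Carrier) → V⊗ → Carrier
  eval⊗ f = foldr (λ t acc → proj₁ t * f (proj₁ (proj₂ t)) (proj₂ (proj₂ t)) +ₖ acc) 0#

  Invariant : (Cx → Carrier) → Set (lsuc lzero ⊔ ℓ)
  Invariant f = ∀ {Γ Δ} → Γ ≅ Δ → f Γ ≈ f Δ

  Invariant₂ : (Cx → Cx → Carrier) → Set (lsuc lzero ⊔ ℓ)
  Invariant₂ f = ∀ {Γ Γ′ Δ Δ′} → Γ ≅ Γ′ → Δ ≅ Δ′ → f Γ Δ ≈ f Γ′ Δ′

  infix 4 _≈ᵥ_ _≈⊗_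
  _≈ᵥ_ : V → V → Set (lsuc lzero ⊔ c ⊔ ℓ)
  v ≈ᵥ w = ∀ (f : Cx → Carrier) → Invariant f → eval f v ≈ eval f w

  _≈⊗_ : V⊗ → V⊗ → Set (lsuc lzero ⊔ c ⊔ ℓ)
  v ≈⊗ w = ∀ (f : Cx → Cx → Carrier) → Invariant₂ f → eval⊗ f v ≈ eval⊗ f w

  ⟦_⟧ : Cx → V
  ⟦ Γ ⟧ = (1# , Γ) ∷ []

  scale : Carrier → V → V
  scale a = map (λ t → a * proj₁ t , proj₂ t)

  infixl 7 _·_
  _·_ : V → V → V
  a · b = concatMap (λ s → map (λ t → proj₁ s * proj₁ t , proj₂ s ⊔ᶜ proj₂ t) b) a

  𝟏 : V
  𝟏 = ⟦ 𝟙ᶜ ⟧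

  εᶜ : Cx → Carrier
  εᶜ (zero , _) = 1#
  εᶜ (suc n , _) = 0#

  ε : V → Carrier
  ε = eval εᶜ

  Δ : V → V⊗
  Δ = concatMap (λ s → map (λ p → proj₁ s , proj₁ p , proj₂ p) (Δᶜ (proj₂ s)))

  φ : ℕ → V → V
  φ k = map (λ t → proj₁ t , skelᶜ k (proj₂ t))

  φ⊗φ : ℕ → V⊗ → V⊗
  φ⊗φ k = map (λ t → proj₁ t , skelᶜ k (proj₁ (proj₂ t)) , skelᶜ k (proj₂ (proj₂ t)))

  lin : (Cx → V) → V → V
  lin S = concatMap (λ t → scale (proj₁ t) (S (proj₂ t)))

  record IsAntipode (S : Cx → V) : Set (lsuc lzero ⊔ c ⊔ ℓ) where
    field
      well-defined : ∀ {Γ Δ′} → Γ ≅ Δ′ → S Γ ≈ᵥ S Δ′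
      left  : ∀ Γ → concatMap (λ p → S (proj₁ p) · ⟦ proj₂ p ⟧) (Δᶜ Γ) ≈ᵥ scale (εᶜ Γ) 𝟏
      right : ∀ Γ → concatMap (λ p → ⟦ proj₁ p ⟧ · S (proj₂ p)) (Δᶜ Γ) ≈ᵥ scale (εᶜ Γ) 𝟏

  In𝒜 : ℕ → V → Set (lsuc lzero ⊔ c ⊔ ℓ)
  In𝒜 k v = Σ V λ w → All (λ t → DimLE k (proj₂ t)) w × v ≈ᵥ w

  In𝒜⊗ : ℕ → V⊗ → Set (lsuc lzero ⊔ c ⊔ ℓ)
  In𝒜⊗ k v = Σ V⊗ λ w →
    All (λ t → DimLE k (proj₁ (proj₂ t)) × DimLE k (proj₂ (proj₂ t))) w × v ≈⊗ w

-- The k-skeleton commutes with disjoint unions and with restriction to a set of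
-- vertices, and both operations preserve dimension ≤ k; by linearity this gives
-- everything about the product, unit, counit and coproduct. For an antipode S,
-- the left antipode law solved for its T = V(Γ) term expresses S(Γ) through the
-- S(Γ_T) with T a proper subset, so induction on the number of vertices shows that
-- S maps 𝒜^(k) into itself and commutes with φ_k.
--
-- Elements of 𝒜 are equal when every isomorphism-invariant functional agrees on
-- them, so each linear identity is proved by evaluating both sides.

module Submission where

open import Defs
open import Level using (Level; _⊔_) renaming (suc to lsuc; zero to lzero)
open import Data.Bool using (Bool; true; false; not)
open import Data.Nat using (ℕ; zero; suc; _+_; _≤_; _<_; z≤n; s≤s)
open import Data.Nat.Induction using (<-rec)
open import Data.Nat.Properties using (≤-trans; m≤m+n; m≤n+m; m≤n⇒m≤1+n; n≤0⇒n≡0)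
import Data.Nat.Properties as ℕ
open import Data.Fin using (Fin; zero; suc; _↑ˡ_; _↑ʳ_; splitAt; join; punchIn; punchOut)
open import Data.Fin.Properties
  using (+↔⊎; suc-injective; splitAt-↑ˡ; splitAt-↑ʳ; join-splitAt; punchIn-punchOut; _≟_)
open import Data.Fin.Permutation using (remove; punchIn-permute; ↔⇒≡; inverseˡ; inverseʳ)
open import Data.Product using (Σ; _×_; _,_; proj₁; proj₂)
open import Data.Sum as Sum using (_⊎_; inj₁; inj₂; [_,_])
open import Data.Unit using (tt)
open import Data.List using (List; []; _∷_; _++_; map; concatMap; foldr)
open import Data.List.Properties
  using (++-assoc; ++-identityʳ; concatMap-++; concatMap-map; foldr-map; map-++; map-∘; map-concatMap)
open import Data.List.Relation.Unary.All as All using (All; []; _∷_; universal)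
open import Data.List.Relation.Unary.All.Properties using (++⁺; map⁺)
open import Data.Sum.Function.Propositional using (_⊎-↔_)
open import Relation.Nullary using (yes; no)
open import Relation.Binary.PropositionalEquality using (_≡_; refl; sym; trans; cong; subst)
open import Relation.Binary.Bundles using (Setoid)
import Relation.Binary.Reasoning.Setoid as SetoidReasoning
open import Function.Base using (_∘_; id)
open import Function.Bundles using (_↔_; Inverse; mk↔ₛ′)
open import Function.Construct.Composition using (_↔-∘_)
open import Function.Construct.Identity using (↔-id)
open import Function.Construct.Symmetry using (↔-sym)

private
  variable
    a b : Level
    A : Set a
    B : Set b

-- Enumerating a subset

emb-∈ : ∀ {n} (T : Subset n) (i : Fin ∣ T ∣) → T (emb T i) ≡ true
emb-∈ {suc n} T i with T zero in eq
emb-∈ {suc n} T zero    | true  = eq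
emb-∈ {suc n} T (suc i) | true  = emb-∈ (T ∘ suc) i
emb-∈ {suc n} T i       | false = emb-∈ (T ∘ suc) i

embStep-injective : ∀ {m n} b (e : Fin m → Fin n) → (∀ {i j} → e i ≡ e j → i ≡ j) →
                    ∀ {i j} → embStep b e i ≡ embStep b e j → i ≡ j
embStep-injective true  e inj {zero}  {zero}  p = refl
embStep-injective true  e inj {suc i} {suc j} p = cong suc (inj (suc-injective p))
embStep-injective false e inj p = inj (suc-injective p)

emb-injective : ∀ {n} (T : Subset n) {i j} → emb T i ≡ emb T j → i ≡ j
emb-injective {suc n} T = embStep-injective (T zero) (emb (T ∘ suc)) (emb-injective (T ∘ suc))

-- T zero is split on by hand, with its equation: a with-abstraction over T zero
-- would make emb-emb⁻¹ ill-typed.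
emb⁻¹ : ∀ {n} (T : Subset n) (j : Fin n) → T j ≡ true → Fin ∣ T ∣
emb⁻¹-at : ∀ {n} (T : Subset (suc n)) b → T zero ≡ b → (j : Fin (suc n)) → T j ≡ true →
           Fin (add b ∣ T ∘ suc ∣)
emb⁻¹ {suc n} T = emb⁻¹-at T (T zero) refl
emb⁻¹-at T true  _  zero    _ = zero
emb⁻¹-at T true  _  (suc j) p = suc (emb⁻¹ (T ∘ suc) j p)
emb⁻¹-at T false eq zero    p with () ← trans (sym p) eq
emb⁻¹-at T false _  (suc j) p = emb⁻¹ (T ∘ suc) j p

emb-emb⁻¹ : ∀ {n} (T : Subset n) j p → emb T (emb⁻¹ T j p) ≡ j
emb-emb⁻¹-at : ∀ {n} (T : Subset (suc n)) b (eq : T zero ≡ b) j p →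
               embStep b (emb (T ∘ suc)) (emb⁻¹-at T b eq j p) ≡ j
emb-emb⁻¹ {suc n} T = emb-emb⁻¹-at T (T zero) refl
emb-emb⁻¹-at T true  _  zero    _ = refl
emb-emb⁻¹-at T true  _  (suc j) p = cong suc (emb-emb⁻¹ (T ∘ suc) j p)
emb-emb⁻¹-at T false eq zero    p with () ← trans (sym p) eq
emb-emb⁻¹-at T false _  (suc j) p = cong suc (emb-emb⁻¹ (T ∘ suc) j p)

emb⁻¹-emb : ∀ {n} (T : Subset n) i p → emb⁻¹ T (emb T i) p ≡ i
emb⁻¹-emb T i p = emb-injective T (emb-emb⁻¹ T (emb T i) p)

-- A bijection σ carrying T onto T′ restricts to a bijection of their enumerations.
module Restricted {m n} (σ : Fin m ↔ Fin n) (T : Subset m) (T′ : Subset n)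
                  (σT≡T′ : ∀ i → T′ (Inverse.to σ i) ≡ T i) where
  private
    to : Fin m → Fin n
    to = Inverse.to σ
    from : Fin n → Fin m
    from = Inverse.from σ

  to′ : Fin ∣ T ∣ → Fin ∣ T′ ∣
  to′ i = emb⁻¹ T′ (to (emb T i)) (trans (σT≡T′ _) (emb-∈ T i))

  from′ : Fin ∣ T′ ∣ → Fin ∣ T ∣
  from′ j = emb⁻¹ T (from (emb T′ j))
    (trans (sym (σT≡T′ (from _))) (trans (cong T′ (inverseʳ σ)) (emb-∈ T′ j)))

  emb-to′ : ∀ i → emb T′ (to′ i) ≡ to (emb T i)
  emb-to′ i = emb-emb⁻¹ T′ _ _

  emb-from′ : ∀ j → emb T (from′ j) ≡ from (emb T′ j)
  emb-from′ j = emb-emb⁻¹ T _ _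

  σ′ : Fin ∣ T ∣ ↔ Fin ∣ T′ ∣
  σ′ = mk↔ₛ′ to′ from′
    (λ j → emb-injective T′ (trans (emb-to′ (from′ j)) (trans (cong to (emb-from′ j)) (inverseʳ σ))))
    (λ i → emb-injective T (trans (emb-from′ (to′ i)) (trans (cong from (emb-to′ i)) (inverseˡ σ))))

image : ∀ {n} (T : Subset n) → Subset ∣ T ∣ → Subset n
image {zero}  T Y = Y
image {suc n} T Y with T zero
... | true  = cons (Y zero) (image (T ∘ suc) (Y ∘ suc))
... | false = cons false (image (T ∘ suc) Y)

image-emb : ∀ {n} (T : Subset n) Y i → image T Y (emb T i) ≡ Y i
image-emb {suc n} T Y i with T zero
image-emb {suc n} T Y zero    | true  = refl
image-emb {suc n} T Y (suc i) | true  = image-emb (T ∘ suc) (Y ∘ suc) i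
image-emb {suc n} T Y i       | false = image-emb (T ∘ suc) Y i

image-⊆ : ∀ {n} (T : Subset n) {Y X} → Y ⊆ (X ∘ emb T) → image T Y ⊆ X
image-⊆ {suc n} T Y⊆X j q with T zero
image-⊆ {suc n} T Y⊆X zero    q | true  = Y⊆X zero q
image-⊆ {suc n} T Y⊆X (suc j) q | true  = image-⊆ (T ∘ suc) (λ i → Y⊆X (suc i)) j q
image-⊆ {suc n} T Y⊆X (suc j) q | false = image-⊆ (T ∘ suc) Y⊆X j q

∣image∣ : ∀ {n} (T : Subset n) Y → ∣ image T Y ∣ ≡ ∣ Y ∣
∣image∣ {zero}  T Y = refl
∣image∣ {suc n} T Y with T zero
... | true  = cong (add (Y zero)) (∣image∣ (T ∘ suc) (Y ∘ suc))
... | false = ∣image∣ (T ∘ suc) Y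

∣∣-mono-emb : ∀ {n} (T : Subset n) {Y X} → Y ⊆ (X ∘ emb T) → ∣ Y ∣ ≤ ∣ X ∣
∣∣-mono-emb T {Y} {X} Y⊆X = subst (_≤ ∣ X ∣) (∣image∣ T Y) (∣∣-mono (image-⊆ T Y⊆X))

∣∁∣≡0 : ∀ {n} (T : Subset n) → (∀ j → T j ≡ true) → ∣ ∁ T ∣ ≡ 0
∣∁∣≡0 T full = n≤0⇒n≡0 (∣∅∣ (∁ T) (λ i → cong not (full i)))

∣∣≤n : ∀ {n} (X : Subset n) → ∣ X ∣ ≤ n
∣∣≤n {zero}  X = z≤n
∣∣≤n {suc n} X with X zero
... | true  = s≤s (∣∣≤n (X ∘ suc))
... | false = m≤n⇒m≤1+n (∣∣≤n (X ∘ suc))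

restrictˡ : ∀ {m} n → Subset (m + n) → Subset m
restrictˡ n X i = X (i ↑ˡ n)

restrictʳ : ∀ m {n} → Subset (m + n) → Subset n
restrictʳ m X i = X (m ↑ʳ i)

∣∣-split : ∀ m n (X : Subset (m + n)) → ∣ X ∣ ≡ ∣ restrictˡ n X ∣ + ∣ restrictʳ m X ∣
∣∣-split zero    n X = refl
∣∣-split (suc m) n X with X zero
... | true  = cong suc (∣∣-split m n (X ∘ suc))
... | false = ∣∣-split m n (X ∘ suc)

∣∣-one-sided : ∀ {m n b} (X : Subset (m + n)) →
  IsEmpty (restrictˡ n X) ⊎ IsEmpty (restrictʳ m X) →
  ∣ restrictˡ n X ∣ ≤ b → ∣ restrictʳ m X ∣ ≤ b → ∣ X ∣ ≤ b
∣∣-one-sided {m} {n} {b} X (inj₁ empty) _ ∣R∣≤ = subst (_≤ b) (sym ∣X∣≡∣R∣) ∣R∣≤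
  where
  ∣X∣≡∣R∣ : ∣ X ∣ ≡ ∣ restrictʳ m X ∣
  ∣X∣≡∣R∣ = trans (∣∣-split m n X)
    (cong (_+ ∣ restrictʳ m X ∣) (n≤0⇒n≡0 (∣∅∣ _ empty)))
∣∣-one-sided {m} {n} {b} X (inj₂ empty) ∣L∣≤ _ = subst (_≤ b) (sym ∣X∣≡∣L∣) ∣L∣≤
  where
  ∣X∣≡∣L∣ : ∣ X ∣ ≡ ∣ restrictˡ n X ∣
  ∣X∣≡∣L∣ = trans (∣∣-split m n X)
    (trans (cong (∣ restrictˡ n X ∣ +_) (n≤0⇒n≡0 (∣∅∣ _ empty))) (ℕ.+-identityʳ _))

allSubsets-split : ∀ n → Σ (List (Subset n)) λ L → Σ (Subset n) λ F →
  allSubsets n ≡ L ++ F ∷ [] × (∀ j → F j ≡ true) × All (λ T → ∣ T ∣ < n) L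
allSubsets-split zero = [] , _ , refl , (λ ()) , []
allSubsets-split (suc n) with allSubsets-split n
... | L , F , eq , full , proper =
  concatMap extend L ++ cons false F ∷ [] , cons true F , eq′ , full′ ,
  ++⁺ (proper′ L proper) (s≤s (∣∣≤n F) ∷ [])
  where
  extend : Subset n → List (Subset (suc n))
  extend X = cons false X ∷ cons true X ∷ []
  eq′ : allSubsets (suc n) ≡ (concatMap extend L ++ cons false F ∷ []) ++ cons true F ∷ []
  eq′ = trans (cong (concatMap extend) eq) (trans (concatMap-++ extend L (F ∷ []))
          (sym (++-assoc (concatMap extend L) (cons false F ∷ []) (cons true F ∷ []))))
  full′ : ∀ j → cons true F j ≡ true
  full′ zero    = refl
  full′ (suc j) = full j
  proper′ : ∀ L → All (λ T → ∣ T ∣ < n) L → All (λ T → ∣ T ∣ < suc n) (concatMap extend L)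
  proper′ []      []       = []
  proper′ (X ∷ L) (p ∷ ps) = m≤n⇒m≤1+n p ∷ s≤s p ∷ proper′ L ps

insert : ∀ {n} → Fin (suc n) → Bool → Subset n → Subset (suc n)
insert         zero    b X = cons b X
insert {suc n} (suc j) b X = cons (X zero) (insert j b (X ∘ suc))

insert-at : ∀ {n} (j : Fin (suc n)) b X → insert j b X j ≡ b
insert-at         zero    b X = refl
insert-at {suc n} (suc j) b X = insert-at j b (X ∘ suc)

insert-punchIn : ∀ {n} (j : Fin (suc n)) b X i → insert j b X (punchIn j i) ≡ X i
insert-punchIn         zero    b X i       = refl
insert-punchIn {suc n} (suc j) b X zero    = refl
insert-punchIn {suc n} (suc j) b X (suc i) = insert-punchIn j b (X ∘ suc) i

insert-cong : ∀ {n} (j : Fin (suc n)) b {X Y : Subset n} → (∀ i → X i ≡ Y i) →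
              ∀ i → insert j b X i ≡ insert j b Y i
insert-cong         zero    b p zero    = refl
insert-cong         zero    b p (suc i) = p i
insert-cong {suc n} (suc j) b p zero    = p zero
insert-cong {suc n} (suc j) b p (suc i) = insert-cong j b (p ∘ suc) i

module _ {m n} (σ : Fin (suc m) ↔ Fin (suc n)) where
  private
    j : Fin (suc n)
    j = Inverse.to σ zero
    from₀ : Fin n → Fin m
    from₀ = Inverse.from (remove zero σ)

  insert-remove-punchIn : ∀ b (Y : Subset m) i →
    insert j b (Y ∘ from₀) (punchIn j i) ≡ cons b Y (Inverse.from σ (punchIn j i))
  insert-remove-punchIn b Y i = trans (insert-punchIn j b _ i) (sym (cong (cons b Y) from-punchIn))
    where
    from-punchIn : Inverse.from σ (punchIn j i) ≡ suc (from₀ i)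
    from-punchIn = trans (cong (Inverse.from σ) (sym (trans (punchIn-permute σ zero (from₀ i))
                     (cong (punchIn j) (inverseʳ (remove zero σ)))))) (inverseˡ σ)

  insert-remove : ∀ b (Y : Subset m) k → insert j b (Y ∘ from₀) k ≡ cons b Y (Inverse.from σ k)
  insert-remove b Y k with k ≟ j
  ... | yes refl = trans (insert-at j b (Y ∘ from₀)) (cong (cons b Y) (sym (inverseˡ σ)))
  ... | no k≢j = subst (λ z → insert j b (Y ∘ from₀) z ≡ cons b Y (Inverse.from σ z))
                   (punchIn-punchOut (k≢j ∘ sym)) (insert-remove-punchIn b Y _)

_⊕_ : ∀ {m m′ n n′} → Fin m ↔ Fin m′ → Fin n ↔ Fin n′ → Fin (m + n) ↔ Fin (m′ + n′)
σ ⊕ τ = ↔-sym +↔⊎ ↔-∘ ((σ ⊎-↔ τ) ↔-∘ +↔⊎)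

module _ {m m′ n n′} (σ : Fin m ↔ Fin m′) (τ : Fin n ↔ Fin n′) where
  ⊕-to-↑ˡ : ∀ j → Inverse.to (σ ⊕ τ) (j ↑ˡ n) ≡ Inverse.to σ j ↑ˡ n′
  ⊕-to-↑ˡ j rewrite splitAt-↑ˡ m j n = refl

  ⊕-to-↑ʳ : ∀ j → Inverse.to (σ ⊕ τ) (m ↑ʳ j) ≡ m′ ↑ʳ Inverse.to τ j
  ⊕-to-↑ʳ j rewrite splitAt-↑ʳ m n j = refl

  ⊕-from-↑ˡ : ∀ j → Inverse.from (σ ⊕ τ) (j ↑ˡ n′) ≡ Inverse.from σ j ↑ˡ n
  ⊕-from-↑ˡ j rewrite splitAt-↑ˡ m′ j n′ = refl

  ⊕-from-↑ʳ : ∀ j → Inverse.from (σ ⊕ τ) (m′ ↑ʳ j) ≡ m ↑ʳ Inverse.from τ j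
  ⊕-from-↑ʳ j rewrite splitAt-↑ʳ m′ n′ j = refl

-- Isomorphisms of simplicial complexes

Face-resp : ∀ {n} (Γ : Complex n) {X Y : Subset n} → (∀ i → Y i ≡ X i) → Face Γ X → Face Γ Y
Face-resp Γ p = down Γ (≡⇒⊆ p)

≅-intro : ∀ {m n} (Γ : Complex m) (Δ : Complex n) (σ : Fin m ↔ Fin n) →
  (∀ X → Face Γ X → Face Δ (X ∘ Inverse.from σ)) →
  (∀ Y → Face Δ Y → Face Γ (Y ∘ Inverse.to σ)) → (m , Γ) ≅ (n , Δ)
≅-intro Γ Δ σ to-face from-face =
  σ , λ X → to-face X , λ d → Face-resp Γ (λ i → cong X (sym (inverseˡ σ))) (from-face _ d)

module ≅-Faces {m n} (Γ : Complex m) (Δ : Complex n) (I : (m , Γ) ≅ (n , Δ)) where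
  σ : Fin m ↔ Fin n
  σ = proj₁ I
  to : Fin m → Fin n
  to = Inverse.to σ
  from : Fin n → Fin m
  from = Inverse.from σ

  to-face : ∀ X → Face Γ X → Face Δ (X ∘ from)
  to-face X = proj₁ (proj₂ I X)

  from-face : ∀ Y → Face Δ Y → Face Γ (Y ∘ to)
  from-face Y d = proj₂ (proj₂ I (Y ∘ to)) (Face-resp Δ (λ j → cong Y (inverseʳ σ)) d)

≅-refl : ∀ (A : Cx) → A ≅ A
≅-refl (n , Γ) = ≅-intro Γ Γ (↔-id _) (λ X d → d) (λ Y d → d)

≅-sym : ∀ {A B : Cx} → A ≅ B → B ≅ A
≅-sym {m , Γ} {n , Δ} I = ≅-intro Δ Γ (↔-sym σ) from-face to-face
  where open ≅-Faces Γ Δ I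

∣∘to∣ : ∀ {m n} (σ : Fin m ↔ Fin n) (Y : Subset n) → ∣ Y ∘ Inverse.to σ ∣ ≡ ∣ Y ∣
∣∘to∣ σ Y = ↔⇒≡ (Restricted.σ′ σ (Y ∘ Inverse.to σ) Y (λ i → refl))

restrictᶜ : ∀ {n} → Complex n → Subset n → Cx
restrictᶜ Γ T = ∣ T ∣ , restrict Γ T

restrict-≅ : ∀ {m n} (Γ : Complex m) (Γ′ : Complex n) (I : (m , Γ) ≅ (n , Γ′))
  (T : Subset m) (T′ : Subset n) → (∀ i → T′ (Inverse.to (proj₁ I) i) ≡ T i) →
  restrictᶜ Γ T ≅ restrictᶜ Γ′ T′
restrict-≅ Γ Γ′ I T T′ σT≡T′ =
  ≅-intro (restrict Γ T) (restrict Γ′ T′) σ′ to-face′ from-face′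
  where
  open ≅-Faces Γ Γ′ I
  open Restricted σ T T′ σT≡T′
  to-face′ : ∀ Y → Face (restrict Γ T) Y → Face (restrict Γ′ T′) (Y ∘ from′)
  to-face′ Y (X , f , Y⊆X) = X ∘ from , to-face X f ,
    λ j q → subst (λ z → X z ≡ true) (emb-from′ j) (Y⊆X (from′ j) q)
  from-face′ : ∀ Y → Face (restrict Γ′ T′) Y → Face (restrict Γ T) (Y ∘ to′)
  from-face′ Y (X , f , Y⊆X) = X ∘ to , from-face X f ,
    λ i q → subst (λ z → X z ≡ true) (emb-to′ i) (Y⊆X (to′ i) q)

restrict-full-≅ : ∀ {n} (Γ : Complex n) (T : Subset n) → (∀ j → T j ≡ true) →
                  restrictᶜ Γ T ≅ (n , Γ)
restrict-full-≅ {n} Γ T full = ≅-intro (restrict Γ T) Γ σ to-face (λ Y f → Y , f , λ i q → q)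
  where
  σ : Fin ∣ T ∣ ↔ Fin n
  σ = mk↔ₛ′ (emb T) (λ j → emb⁻¹ T j (full j)) (λ j → emb-emb⁻¹ T j (full j))
            (λ i → emb⁻¹-emb T i (full (emb T i)))
  to-face : ∀ Y → Face (restrict Γ T) Y → Face Γ (Y ∘ Inverse.from σ)
  to-face Y (X , f , Y⊆X) =
    down Γ (λ j q → subst (λ z → X z ≡ true) (emb-emb⁻¹ T j (full j)) (Y⊆X _ q)) f

skelᶜ-restrictᶜ : ∀ {n} k (Γ : Complex n) (T : Subset n) →
  skelᶜ k (restrictᶜ Γ T) ≅ restrictᶜ (skeleton k Γ) T
skelᶜ-restrictᶜ k Γ T =
  ≅-intro (skeleton k (restrict Γ T)) (restrict (skeleton k Γ) T) (↔-id _) to-face from-face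
  where
  -- X may be too large for the skeleton, but the image of Y is a face of the same size as Y.
  to-face : ∀ Y → Face (skeleton k (restrict Γ T)) Y → Face (restrict (skeleton k Γ) T) Y
  to-face Y ((X , f , Y⊆X) , ∣Y∣≤) =
    image T Y , (down Γ (image-⊆ T Y⊆X) f , subst (_≤ suc k) (sym (∣image∣ T Y)) ∣Y∣≤) ,
    λ i q → trans (image-emb T Y i) q
  from-face : ∀ Y → Face (restrict (skeleton k Γ) T) Y → Face (skeleton k (restrict Γ T)) Y
  from-face Y (X , (f , ∣X∣≤) , Y⊆X) = (X , f , Y⊆X) , ≤-trans (∣∣-mono-emb T Y⊆X) ∣X∣≤

DimLE-restrict : ∀ {n} k (Γ : Complex n) (T : Subset n) → DimLE k (n , Γ) → DimLE k (restrictᶜ Γ T)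
DimLE-restrict k Γ T dim Y (X , f , Y⊆X) = ≤-trans (∣∣-mono-emb T Y⊆X) (dim X f)

skelᶜ-cong : ∀ k {A B : Cx} → A ≅ B → skelᶜ k A ≅ skelᶜ k B
skelᶜ-cong k {m , Γ} {n , Δ} I = ≅-intro (skeleton k Γ) (skeleton k Δ) σ
  (λ X (f , ∣X∣≤) → to-face X f , subst (_≤ suc k) (sym (∣∘to∣ (↔-sym σ) X)) ∣X∣≤)
  (λ Y (f , ∣Y∣≤) → from-face Y f , subst (_≤ suc k) (sym (∣∘to∣ σ Y)) ∣Y∣≤)
  where open ≅-Faces Γ Δ I

skelᶜ-𝟙ᶜ : ∀ k → skelᶜ k 𝟙ᶜ ≅ 𝟙ᶜ
skelᶜ-𝟙ᶜ k = ≅-intro (skeleton k 𝟘) 𝟘 (↔-id _) (λ X d → tt) (λ Y d → tt , z≤n)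

DimLE-skelᶜ : ∀ k (A : Cx) → DimLE k (skelᶜ k A)
DimLE-skelᶜ k (n , Γ) X (f , ∣X∣≤) = ∣X∣≤

DimLE-𝟙ᶜ : ∀ k → DimLE k 𝟙ᶜ
DimLE-𝟙ᶜ k X _ = z≤n

DimLE-⊔ᶜ : ∀ k {A B : Cx} → DimLE k A → DimLE k B → DimLE k (A ⊔ᶜ B)
DimLE-⊔ᶜ k dimA dimB X (f , g , one-sided) = ∣∣-one-sided X one-sided (dimA _ f) (dimB _ g)

skelᶜ-⊔ᶜ : ∀ k (A B : Cx) → skelᶜ k (A ⊔ᶜ B) ≅ (skelᶜ k A ⊔ᶜ skelᶜ k B)
skelᶜ-⊔ᶜ k (m , Γ) (n , Δ) =
  ≅-intro (skeleton k (union Γ Δ)) (union (skeleton k Γ) (skeleton k Δ)) (↔-id _) to-face from-face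
  where
  to-face : ∀ X → Face (skeleton k (union Γ Δ)) X → Face (union (skeleton k Γ) (skeleton k Δ)) X
  to-face X ((f , g , one-sided) , ∣X∣≤) =
    (f , ≤-trans (subst (∣ restrictˡ n X ∣ ≤_) (sym (∣∣-split m n X)) (m≤m+n _ _)) ∣X∣≤) ,
    (g , ≤-trans (subst (∣ restrictʳ m X ∣ ≤_) (sym (∣∣-split m n X)) (m≤n+m _ _)) ∣X∣≤) ,
    one-sided
  from-face : ∀ X → Face (union (skeleton k Γ) (skeleton k Δ)) X → Face (skeleton k (union Γ Δ)) X
  from-face X ((f , ∣L∣≤) , (g , ∣R∣≤) , one-sided) =
    (f , g , one-sided) , ∣∣-one-sided X one-sided ∣L∣≤ ∣R∣≤

IsEmpty-resp : ∀ {m n} {X : Subset m} {Y : Subset n} {g : Fin n → Fin m} →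
               (∀ i → Y i ≡ X (g i)) → IsEmpty X → IsEmpty Y
IsEmpty-resp Y≗X∘g empty i = trans (Y≗X∘g i) (empty _)

⊔ᶜ-cong : ∀ {A A′ B B′ : Cx} → A ≅ A′ → B ≅ B′ → (A ⊔ᶜ B) ≅ (A′ ⊔ᶜ B′)
⊔ᶜ-cong {m , Γ} {m′ , Γ′} {n , Δ} {n′ , Δ′} I J =
  ≅-intro (union Γ Δ) (union Γ′ Δ′) σ to-face from-face
  where
  module I = ≅-Faces Γ Γ′ I
  module J = ≅-Faces Δ Δ′ J
  σ : Fin (m + n) ↔ Fin (m′ + n′)
  σ = I.σ ⊕ J.σ
  to-face : ∀ X → Face (union Γ Δ) X → Face (union Γ′ Δ′) (X ∘ Inverse.from σ)
  to-face X (f , g , one-sided) =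
    Face-resp Γ′ left (I.to-face _ f) , Face-resp Δ′ right (J.to-face _ g) ,
    Sum.map (IsEmpty-resp left) (IsEmpty-resp right) one-sided
    where
    left : ∀ i → X (Inverse.from σ (i ↑ˡ n′)) ≡ X (I.from i ↑ˡ n)
    left i = cong X (⊕-from-↑ˡ I.σ J.σ i)
    right : ∀ i → X (Inverse.from σ (m′ ↑ʳ i)) ≡ X (m ↑ʳ J.from i)
    right i = cong X (⊕-from-↑ʳ I.σ J.σ i)
  from-face : ∀ Y → Face (union Γ′ Δ′) Y → Face (union Γ Δ) (Y ∘ Inverse.to σ)
  from-face Y (f , g , one-sided) =
    Face-resp Γ left (I.from-face _ f) , Face-resp Δ right (J.from-face _ g) ,
    Sum.map (IsEmpty-resp left) (IsEmpty-resp right) one-sided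
    where
    left : ∀ i → Y (Inverse.to σ (i ↑ˡ n)) ≡ Y (I.to i ↑ˡ n′)
    left i = cong Y (⊕-to-↑ˡ I.σ J.σ i)
    right : ∀ i → Y (Inverse.to σ (m ↑ʳ i)) ≡ Y (m′ ↑ʳ J.to i)
    right i = cong Y (⊕-to-↑ʳ I.σ J.σ i)

⊔ᶜ-identityʳ : ∀ {m n} (Γ : Complex m) (Z : Complex n) → n ≡ 0 →
               ((m , Γ) ⊔ᶜ (n , Z)) ≅ (m , Γ)
⊔ᶜ-identityʳ {m} Γ Z refl = ≅-intro (union Γ Z) Γ σ (λ X (f , _ , _) → f) from-face
  where
  to : Fin (m + 0) → Fin m
  to = [ id , (λ ()) ] ∘ splitAt m
  to-↑ˡ : ∀ j → to (j ↑ˡ 0) ≡ j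
  to-↑ˡ j = cong [ id , (λ ()) ] (splitAt-↑ˡ m j 0)
  ↑ˡ-to : ∀ i → to i ↑ˡ 0 ≡ i
  ↑ˡ-to i with splitAt m i in eq
  ... | inj₁ j = trans (cong (join m 0) (sym eq)) (join-splitAt m 0 i)
  σ : Fin (m + 0) ↔ Fin m
  σ = mk↔ₛ′ to (_↑ˡ 0) to-↑ˡ ↑ˡ-to
  from-face : ∀ Y → Face Γ Y → Face (union Γ Z) (Y ∘ to)
  from-face Y f = Face-resp Γ (λ i → cong Y (to-↑ˡ i)) f , down Z (λ ()) (∅∈ Z) , inj₂ (λ ())

-- Formal linear combinations

module LinearCombinations {c ℓ} (K : Field c ℓ) where
  open Space K hiding (zero; refl; sym; trans; reflexive; setoid)
  open Space K using (setoid)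
    renaming (refl to ≈-refl; sym to ≈-sym; trans to ≈-trans; reflexive to ≈-reflexive)
  module ≈-Reasoning = SetoidReasoning setoid
  open import Algebra.Properties.Group +-group using (y≈x\\z)
  open import Algebra.Properties.Ring ring using (-1*x≈-x)
  open import Algebra.Properties.CommutativeSemigroup +-commutativeSemigroup using (interchange)

  ∑ : (A → Carrier) → List A → Carrier
  ∑ h = foldr (λ x acc → h x +ₖ acc) 0#

  ∑-cong : ∀ {h h′ : A → Carrier} → (∀ x → h x ≈ h′ x) → ∀ xs → ∑ h xs ≈ ∑ h′ xs
  ∑-cong p []       = ≈-refl
  ∑-cong p (x ∷ xs) = +-cong (p x) (∑-cong p xs)

  ∑-++ : ∀ (h : A → Carrier) xs ys → ∑ h (xs ++ ys) ≈ ∑ h xs +ₖ ∑ h ys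
  ∑-++ h []       ys = ≈-sym (+-identityˡ _)
  ∑-++ h (x ∷ xs) ys = ≈-trans (+-cong ≈-refl (∑-++ h xs ys)) (≈-sym (+-assoc _ _ _))

  ∑-+ : ∀ (h h′ : A → Carrier) xs → ∑ (λ x → h x +ₖ h′ x) xs ≈ ∑ h xs +ₖ ∑ h′ xs
  ∑-+ h h′ []       = ≈-sym (+-identityˡ 0#)
  ∑-+ h h′ (x ∷ xs) = ≈-trans (+-cong ≈-refl (∑-+ h h′ xs)) (interchange _ _ _ _)

  ∑-distribˡ : ∀ (h : A → Carrier) r xs → r * ∑ h xs ≈ ∑ (λ x → r * h x) xs
  ∑-distribˡ h r []       = zeroʳ r
  ∑-distribˡ h r (x ∷ xs) = ≈-trans (distribˡ r _ _) (+-cong ≈-refl (∑-distribˡ h r xs))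

  ∑-map : ∀ (h : B → Carrier) (g : A → B) xs → ∑ h (map g xs) ≡ ∑ (h ∘ g) xs
  ∑-map h g = foldr-map (λ y acc → h y +ₖ acc) g 0#

  ∑-concatMap : ∀ (h : B → Carrier) (g : A → List B) xs →
                ∑ h (concatMap g xs) ≈ ∑ (∑ h ∘ g) xs
  ∑-concatMap h g []       = ≈-refl
  ∑-concatMap h g (x ∷ xs) =
    ≈-trans (∑-++ h (g x) (concatMap g xs)) (+-cong ≈-refl (∑-concatMap h g xs))

  -- eval f and eval⊗ f are ∑ of these, definitionally.
  term : (Cx → Carrier) → Carrier × Cx → Carrier
  term f t = proj₁ t * f (proj₂ t)

  term⊗ : (Cx → Cx → Carrier) → Carrier × Cx × Cx → Carrier
  term⊗ f t = proj₁ t * f (proj₁ (proj₂ t)) (proj₂ (proj₂ t))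

  eval-cong : ∀ {f g : Cx → Carrier} → (∀ A → f A ≈ g A) → ∀ v → eval f v ≈ eval g v
  eval-cong p = ∑-cong (λ t → *-cong ≈-refl (p (proj₂ t)))

  eval-map : ∀ f (h : Cx → Cx) v → eval f (map (λ t → proj₁ t , h (proj₂ t)) v) ≡ eval (f ∘ h) v
  eval-map f h = ∑-map (term f) _

  eval-map-scale : ∀ f r (h : Cx → Cx) v →
                   eval f (map (λ t → r * proj₁ t , h (proj₂ t)) v) ≈ r * eval (f ∘ h) v
  eval-map-scale f r h v = begin
    eval f (map (λ t → r * proj₁ t , h (proj₂ t)) v) ≡⟨ ∑-map (term f) _ v ⟩
    ∑ (λ t → r * proj₁ t * f (h (proj₂ t))) v        ≈⟨ ∑-cong (λ t → *-assoc r _ _) v ⟩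
    ∑ (λ t → r * term (f ∘ h) t) v                   ≈⟨ ∑-distribˡ (term (f ∘ h)) r v ⟨
    r * eval (f ∘ h) v                                ∎
    where open ≈-Reasoning

  eval-scale : ∀ f r v → eval f (scale r v) ≈ r * eval f v
  eval-scale f r = eval-map-scale f r id

  eval-· : ∀ f a b → eval f (a · b) ≈ eval (λ A → eval (f ∘ (A ⊔ᶜ_)) b) a
  eval-· f a b = ≈-trans (∑-concatMap (term f) _ a)
    (∑-cong (λ s → eval-map-scale f (proj₁ s) (proj₂ s ⊔ᶜ_) b) a)

  eval-lin : ∀ f S a → eval f (lin S a) ≈ eval (λ A → eval f (S A)) a
  eval-lin f S a = ≈-trans (∑-concatMap (term f) _ a)
    (∑-cong (λ t → eval-scale f (proj₁ t) (S (proj₂ t))) a)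

  -- _≈ᵥ_ unfolds to a function type, so Agda cannot infer its arguments;
  -- wrapped in a record they become inferable.
  infix 4 _≋_
  record _≋_ (v w : V) : Set (lsuc lzero ⊔ c ⊔ ℓ) where
    constructor ≈ᵥ⇒≋
    field ≋⇒≈ᵥ : v ≈ᵥ w
  open _≋_ public

  ≋-setoid : Setoid _ _
  ≋-setoid = record
    { _≈_ = _≋_
    ; isEquivalence = record
      { refl  = ≈ᵥ⇒≋ λ _ _ → ≈-refl
      ; sym   = λ (≈ᵥ⇒≋ p) → ≈ᵥ⇒≋ λ f inv → ≈-sym (p f inv)
      ; trans = λ (≈ᵥ⇒≋ p) (≈ᵥ⇒≋ q) → ≈ᵥ⇒≋ λ f inv → ≈-trans (p f inv) (q f inv)
      }
    }

  module ≋ = Setoid ≋-setoid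

  ⟦⟧-cong : ∀ {A B} → A ≅ B → ⟦ A ⟧ ≋ ⟦ B ⟧
  ⟦⟧-cong {A} {B} I = ≈ᵥ⇒≋ λ f inv → +-cong (*-cong ≈-refl (inv {A} {B} I)) ≈-refl

  ++-cong : ∀ {v v′ w w′} → v ≋ v′ → w ≋ w′ → v ++ w ≋ v′ ++ w′
  ++-cong {v} {v′} {w} {w′} (≈ᵥ⇒≋ p) (≈ᵥ⇒≋ q) = ≈ᵥ⇒≋ λ f inv → begin
    eval f (v ++ w)         ≈⟨ ∑-++ (term f) v w ⟩
    eval f v +ₖ eval f w    ≈⟨ +-cong (p f inv) (q f inv) ⟩
    eval f v′ +ₖ eval f w′  ≈⟨ ∑-++ (term f) v′ w′ ⟨
    eval f (v′ ++ w′)       ∎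
    where open ≈-Reasoning

  scale-cong : ∀ {r r′ v w} → r ≈ r′ → v ≋ w → scale r v ≋ scale r′ w
  scale-cong {r} {r′} {v} {w} r≈r′ (≈ᵥ⇒≋ p) = ≈ᵥ⇒≋ λ f inv → begin
    eval f (scale r v)  ≈⟨ eval-scale f r v ⟩
    r * eval f v        ≈⟨ *-cong r≈r′ (p f inv) ⟩
    r′ * eval f w       ≈⟨ eval-scale f r′ w ⟨
    eval f (scale r′ w) ∎
    where open ≈-Reasoning

  concatMap-cong : ∀ {g g′ : A → V} xs → All (λ x → g x ≋ g′ x) xs →
                   concatMap g xs ≋ concatMap g′ xs
  concatMap-cong []       []       = ≋.refl
  concatMap-cong (x ∷ xs) (p ∷ ps) = ++-cong p (concatMap-cong xs ps)

  ·-cong : ∀ {a a′ b b′} → a ≋ a′ → b ≋ b′ → a · b ≋ a′ · b′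
  ·-cong {a} {a′} {b} {b′} (≈ᵥ⇒≋ p) (≈ᵥ⇒≋ q) = ≈ᵥ⇒≋ λ f inv → begin
    eval f (a · b)                            ≈⟨ eval-· f a b ⟩
    eval (λ A → eval (f ∘ (A ⊔ᶜ_)) b) a       ≈⟨ p _ (invariantˡ f inv) ⟩
    eval (λ A → eval (f ∘ (A ⊔ᶜ_)) b) a′
      ≈⟨ eval-cong (λ A → q _ (invariantʳ f inv A)) a′ ⟩
    eval (λ A → eval (f ∘ (A ⊔ᶜ_)) b′) a′     ≈⟨ eval-· f a′ b′ ⟨
    eval f (a′ · b′)                          ∎
    where
    open ≈-Reasoning
    invariantʳ : ∀ f → Invariant f → ∀ A → Invariant (f ∘ (A ⊔ᶜ_))
    invariantʳ f inv A {B} {B′} J =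
      inv {A ⊔ᶜ B} {A ⊔ᶜ B′} (⊔ᶜ-cong {A} {A} {B} {B′} (≅-refl A) J)
    invariantˡ : ∀ f → Invariant f → Invariant (λ A → eval (f ∘ (A ⊔ᶜ_)) b)
    invariantˡ f inv {A} {A′} I =
      eval-cong (λ B → inv {A ⊔ᶜ B} {A′ ⊔ᶜ B} (⊔ᶜ-cong {A} {A′} {B} {B} I (≅-refl B))) b

  module ≋-Reasoning = SetoidReasoning ≋-setoid

  ·-identityʳ : ∀ v {n} (Z : Complex n) → n ≡ 0 → v · ⟦ n , Z ⟧ ≋ v
  ·-identityʳ v {n} Z n≡0 = ≈ᵥ⇒≋ λ f inv →
    ≈-trans (eval-· f v ⟦ n , Z ⟧) (eval-cong (unit f inv) v)
    where
    unit : ∀ f → Invariant f → ∀ A → eval (f ∘ (A ⊔ᶜ_)) ⟦ n , Z ⟧ ≈ f A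
    unit f inv (m , Γ) = ≈-trans (+-identityʳ _) (≈-trans (*-identityˡ _)
      (inv {(m , Γ) ⊔ᶜ (n , Z)} {m , Γ} (⊔ᶜ-identityʳ Γ Z n≡0)))

  u++w≋e⇒w≋e-u : ∀ {u w e} → u ++ w ≋ e → w ≋ e ++ scale (- 1#) u
  u++w≋e⇒w≋e-u {u} {w} {e} (≈ᵥ⇒≋ p) = ≈ᵥ⇒≋ λ f inv → begin
    eval f w                                ≈⟨ y≈x\\z (eval f u) (eval f w) (eval f e)
                                                 (≈-trans (≈-sym (∑-++ (term f) u w)) (p f inv)) ⟩
    - eval f u +ₖ eval f e                  ≈⟨ +-comm _ _ ⟩
    eval f e +ₖ - eval f u                  ≈⟨ +-cong ≈-refl (-1*x≈-x _) ⟨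
    eval f e +ₖ - 1# * eval f u             ≈⟨ +-cong ≈-refl (eval-scale f (- 1#) u) ⟨
    eval f e +ₖ eval f (scale (- 1#) u)     ≈⟨ ∑-++ (term f) e (scale (- 1#) u) ⟨
    eval f (e ++ scale (- 1#) u)            ∎
    where open ≈-Reasoning

  -- The coproduct

  ∑ˢ : ∀ n → (Subset n → Carrier) → Carrier
  ∑ˢ n g = ∑ g (allSubsets n)

  -- Subsets are functions, so without function extensionality a summand has
  -- to be assumed to respect pointwise equality.
  Extensional : ∀ {n} → (Subset n → Carrier) → Set ℓ
  Extensional g = ∀ {X Y} → (∀ i → X i ≡ Y i) → g X ≈ g Y

  ∑ˢ-cong : ∀ n {g g′ : Subset n → Carrier} → (∀ X → g X ≈ g′ X) → ∑ˢ n g ≈ ∑ˢ n g′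
  ∑ˢ-cong n p = ∑-cong p (allSubsets n)

  ∑ˢ-suc : ∀ n (g : Subset (suc n) → Carrier) →
           ∑ˢ (suc n) g ≈ ∑ˢ n (g ∘ cons false) +ₖ ∑ˢ n (g ∘ cons true)
  ∑ˢ-suc n g = begin
    ∑ˢ (suc n) g
      ≈⟨ ∑-concatMap g _ (allSubsets n) ⟩
    ∑ˢ n (λ X → g (cons false X) +ₖ (g (cons true X) +ₖ 0#))
      ≈⟨ ∑ˢ-cong n (λ X → +-cong ≈-refl (+-identityʳ _)) ⟩
    ∑ˢ n (λ X → g (cons false X) +ₖ g (cons true X))
      ≈⟨ ∑-+ (g ∘ cons false) (g ∘ cons true) (allSubsets n) ⟩
    ∑ˢ n (g ∘ cons false) +ₖ ∑ˢ n (g ∘ cons true) ∎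
    where open ≈-Reasoning

  ∑ˢ-insert : ∀ n (j : Fin (suc n)) (g : Subset (suc n) → Carrier) →
              ∑ˢ (suc n) g ≈ ∑ˢ n (g ∘ insert j false) +ₖ ∑ˢ n (g ∘ insert j true)
  ∑ˢ-insert n       zero    g = ∑ˢ-suc n g
  ∑ˢ-insert (suc n) (suc j) g = begin
    ∑ˢ (suc (suc n)) g
      ≈⟨ ∑ˢ-suc (suc n) g ⟩
    ∑ˢ (suc n) (g ∘ cons false) +ₖ ∑ˢ (suc n) (g ∘ cons true)
      ≈⟨ +-cong (∑ˢ-insert n j (g ∘ cons false)) (∑ˢ-insert n j (g ∘ cons true)) ⟩
    (∑ˢ n (g ∘ cons false ∘ insert j false) +ₖ ∑ˢ n (g ∘ cons false ∘ insert j true)) +ₖ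
    (∑ˢ n (g ∘ cons true ∘ insert j false) +ₖ ∑ˢ n (g ∘ cons true ∘ insert j true))
      ≈⟨ interchange _ _ _ _ ⟩
    (∑ˢ n (g ∘ cons false ∘ insert j false) +ₖ ∑ˢ n (g ∘ cons true ∘ insert j false)) +ₖ
    (∑ˢ n (g ∘ cons false ∘ insert j true) +ₖ ∑ˢ n (g ∘ cons true ∘ insert j true))
      ≈⟨ +-cong (∑ˢ-suc n (g ∘ insert (suc j) false)) (∑ˢ-suc n (g ∘ insert (suc j) true)) ⟨
    ∑ˢ (suc n) (g ∘ insert (suc j) false) +ₖ ∑ˢ (suc n) (g ∘ insert (suc j) true) ∎
    where open ≈-Reasoning

  ∑ˢ-relabel : ∀ m n (σ : Fin m ↔ Fin n) (g : Subset n → Carrier) → Extensional g →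
               ∑ˢ n g ≈ ∑ˢ m (λ Y → g (Y ∘ Inverse.from σ))
  ∑ˢ-relabel zero    zero    σ g ext = +-cong (ext (λ ())) ≈-refl
  ∑ˢ-relabel zero    (suc n) σ g ext with () ← Inverse.from σ zero
  ∑ˢ-relabel (suc m) zero    σ g ext with () ← Inverse.to σ zero
  ∑ˢ-relabel (suc m) (suc n) σ g ext = begin
    ∑ˢ (suc n) g
      ≈⟨ ∑ˢ-insert n j g ⟩
    ∑ˢ n (g ∘ insert j false) +ₖ ∑ˢ n (g ∘ insert j true)
      ≈⟨ +-cong (∑ˢ-relabel m n σ₀ (g ∘ insert j false) (ext ∘ insert-cong j false))
                (∑ˢ-relabel m n σ₀ (g ∘ insert j true) (ext ∘ insert-cong j true)) ⟩
    ∑ˢ m (λ Y → g (insert j false (Y ∘ from₀))) +ₖ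
    ∑ˢ m (λ Y → g (insert j true (Y ∘ from₀)))
      ≈⟨ +-cong (∑ˢ-cong m (λ Y → ext (insert-remove σ false Y)))
                (∑ˢ-cong m (λ Y → ext (insert-remove σ true Y))) ⟩
    ∑ˢ m (λ Y → g (cons false Y ∘ Inverse.from σ)) +ₖ
    ∑ˢ m (λ Y → g (cons true Y ∘ Inverse.from σ))
      ≈⟨ ∑ˢ-suc m (λ Y → g (Y ∘ Inverse.from σ)) ⟨
    ∑ˢ (suc m) (λ Y → g (Y ∘ Inverse.from σ)) ∎
    where
    open ≈-Reasoning
    j : Fin (suc n)
    j = Inverse.to σ zero
    σ₀ : Fin m ↔ Fin n
    σ₀ = remove zero σ
    from₀ : Fin n → Fin m
    from₀ = Inverse.from σ₀

  evalΔᶜ : (Cx → Cx → Carrier) → Cx → Carrier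
  evalΔᶜ f (n , Γ) = ∑ˢ n (λ T → f (restrictᶜ Γ T) (restrictᶜ Γ (∁ T)))

  evalΔᶜ-invariant : ∀ f → Invariant₂ f → Invariant (evalΔᶜ f)
  evalΔᶜ-invariant f inv {m , Γ} {n , Γ′} I = begin
    evalΔᶜ f (m , Γ)                 ≈⟨ ∑ˢ-cong m relabel ⟩
    ∑ˢ m (λ T → g′ (T ∘ from))      ≈⟨ ∑ˢ-relabel m n σ g′ g′-extensional ⟨
    evalΔᶜ f (n , Γ′)                ∎
    where
    open ≈-Reasoning
    σ : Fin m ↔ Fin n
    σ = proj₁ I
    from : Fin n → Fin m
    from = Inverse.from σ
    g′ : Subset n → Carrier
    g′ T = f (restrictᶜ Γ′ T) (restrictᶜ Γ′ (∁ T))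
    g′-extensional : Extensional g′
    g′-extensional {X} {Y} X≗Y =
      inv {restrictᶜ Γ′ X} {restrictᶜ Γ′ Y} {restrictᶜ Γ′ (∁ X)} {restrictᶜ Γ′ (∁ Y)}
        (restrict-≅ Γ′ Γ′ (≅-refl (n , Γ′)) X Y (λ i → sym (X≗Y i)))
        (restrict-≅ Γ′ Γ′ (≅-refl (n , Γ′)) (∁ X) (∁ Y) (λ i → cong not (sym (X≗Y i))))
    relabel : ∀ T → f (restrictᶜ Γ T) (restrictᶜ Γ (∁ T)) ≈ g′ (T ∘ from)
    relabel T =
      inv {restrictᶜ Γ T} {restrictᶜ Γ′ (T ∘ from)}
          {restrictᶜ Γ (∁ T)} {restrictᶜ Γ′ (∁ (T ∘ from))}
        (restrict-≅ Γ Γ′ I T (T ∘ from) (λ i → cong T (inverseˡ σ)))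
        (restrict-≅ Γ Γ′ I (∁ T) (∁ (T ∘ from)) (λ i → cong (not ∘ T) (inverseˡ σ)))

  eval⊗-Δ : ∀ f a → eval⊗ f (Δ a) ≈ eval (evalΔᶜ f) a
  eval⊗-Δ f a = ≈-trans (∑-concatMap (term⊗ f) _ a) (∑-cong summand a)
    where
    summand : ∀ s → eval⊗ f (map (λ p → proj₁ s , proj₁ p , proj₂ p) (Δᶜ (proj₂ s))) ≈
                    term (evalΔᶜ f) s
    summand (r , n , Γ) = begin
      eval⊗ f (map (λ p → r , proj₁ p , proj₂ p) (Δᶜ (n , Γ)))
        ≡⟨ ∑-map (term⊗ f) _ (Δᶜ (n , Γ)) ⟩
      ∑ (λ p → r * f (proj₁ p) (proj₂ p)) (Δᶜ (n , Γ))
        ≡⟨ ∑-map _ _ (allSubsets n) ⟩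
      ∑ˢ n (λ T → r * f (restrictᶜ Γ T) (restrictᶜ Γ (∁ T)))
        ≈⟨ ∑-distribˡ _ r (allSubsets n) ⟨
      r * evalΔᶜ f (n , Γ) ∎
      where open ≈-Reasoning

  module Skeletons (k : ℕ) where
    φ-eval : ∀ f v → eval f (φ k v) ≡ eval (f ∘ skelᶜ k) v
    φ-eval f = eval-map f (skelᶜ k)

    ∘skelᶜ-invariant : ∀ f → Invariant f → Invariant (f ∘ skelᶜ k)
    ∘skelᶜ-invariant f inv {A} {B} I = inv {skelᶜ k A} {skelᶜ k B} (skelᶜ-cong k {A} {B} I)

    φ-cong : ∀ {a b} → a ≋ b → φ k a ≋ φ k b
    φ-cong {a} {b} (≈ᵥ⇒≋ p) = ≈ᵥ⇒≋ λ f inv → begin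
      eval f (φ k a)          ≡⟨ φ-eval f a ⟩
      eval (f ∘ skelᶜ k) a    ≈⟨ p _ (∘skelᶜ-invariant f inv) ⟩
      eval (f ∘ skelᶜ k) b    ≡⟨ φ-eval f b ⟨
      eval f (φ k b)          ∎
      where open ≈-Reasoning

    φ-++ : ∀ v w → φ k (v ++ w) ≡ φ k v ++ φ k w
    φ-++ = map-++ _

    φ-scale : ∀ r v → φ k (scale r v) ≡ scale r (φ k v)
    φ-scale r v = trans (sym (map-∘ v)) (map-∘ v)

    φ-concatMap : ∀ (g : A → V) xs → φ k (concatMap g xs) ≡ concatMap (φ k ∘ g) xs
    φ-concatMap = map-concatMap _

    φ-· : ∀ a b → φ k (a · b) ≋ φ k a · φ k b
    φ-· a b = ≈ᵥ⇒≋ λ f inv → begin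
      eval f (φ k (a · b))                                 ≡⟨ φ-eval f (a · b) ⟩
      eval (f ∘ skelᶜ k) (a · b)                           ≈⟨ eval-· (f ∘ skelᶜ k) a b ⟩
      eval (λ A → eval (λ B → f (skelᶜ k (A ⊔ᶜ B))) b) a
        ≈⟨ eval-cong (λ A → eval-cong (λ B → inv (skelᶜ-⊔ᶜ k A B)) b) a ⟩
      eval (λ A → eval (λ B → f (skelᶜ k A ⊔ᶜ skelᶜ k B)) b) a
        ≡⟨ eval-map _ (skelᶜ k) a ⟨
      eval (λ A → eval (λ B → f (A ⊔ᶜ skelᶜ k B)) b) (φ k a)
        ≈⟨ eval-cong (λ A → ≈-reflexive (φ-eval (λ B → f (A ⊔ᶜ B)) b)) (φ k a) ⟨
      eval (λ A → eval (λ B → f (A ⊔ᶜ B)) (φ k b)) (φ k a) ≈⟨ eval-· f (φ k a) (φ k b) ⟨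
      eval f (φ k a · φ k b)                               ∎
      where open ≈-Reasoning

    φ-𝟏 : φ k 𝟏 ≋ 𝟏
    φ-𝟏 = ⟦⟧-cong (skelᶜ-𝟙ᶜ k)

    εᶜ-skelᶜ : ∀ A → εᶜ (skelᶜ k A) ≈ εᶜ A
    εᶜ-skelᶜ (zero  , _) = ≈-refl
    εᶜ-skelᶜ (suc n , _) = ≈-refl

    ε-φ : ∀ a → ε (φ k a) ≈ ε a
    ε-φ a = ≈-trans (≈-reflexive (φ-eval εᶜ a)) (eval-cong εᶜ-skelᶜ a)

    In𝒜-resp : ∀ {v v′} → v ≋ v′ → In𝒜 k v′ → In𝒜 k v
    In𝒜-resp {v′ = v′} v≋v′ (w , dim , v′≈w) =
      w , dim , ≋⇒≈ᵥ (≋.trans v≋v′ (≈ᵥ⇒≋ {v′} {w} v′≈w))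

    In𝒜-⟦⟧ : ∀ A → DimLE k A → In𝒜 k ⟦ A ⟧
    In𝒜-⟦⟧ A dim = ⟦ A ⟧ , dim ∷ [] , λ _ _ → ≈-refl

    In𝒜-++ : ∀ v w → In𝒜 k v → In𝒜 k w → In𝒜 k (v ++ w)
    In𝒜-++ v w (a , dimA , p) (b , dimB , q) =
      a ++ b , ++⁺ dimA dimB , ≋⇒≈ᵥ (++-cong (≈ᵥ⇒≋ {v} {a} p) (≈ᵥ⇒≋ {w} {b} q))

    In𝒜-scale : ∀ r v → In𝒜 k v → In𝒜 k (scale r v)
    In𝒜-scale r v (a , dim , p) =
      scale r a , map⁺ dim , ≋⇒≈ᵥ (scale-cong ≈-refl (≈ᵥ⇒≋ {v} {a} p))

    In𝒜-concatMap : ∀ (g : A → V) xs → All (In𝒜 k ∘ g) xs → In𝒜 k (concatMap g xs)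
    In𝒜-concatMap g []       []       = [] , [] , λ _ _ → ≈-refl
    In𝒜-concatMap g (x ∷ xs) (p ∷ ps) = In𝒜-++ (g x) (concatMap g xs) p (In𝒜-concatMap g xs ps)

    All-DimLE-· : ∀ {a b} → All (DimLE k ∘ proj₂) a → All (DimLE k ∘ proj₂) b →
                  All (DimLE k ∘ proj₂) (a · b)
    All-DimLE-· {[]}    []            _    = []
    All-DimLE-· {s ∷ a} (dimS ∷ dimA) dimB =
      ++⁺ (map⁺ (All.map (λ {t} → DimLE-⊔ᶜ k {proj₂ s} {proj₂ t} dimS) dimB))
          (All-DimLE-· dimA dimB)

    In𝒜-· : ∀ v w → In𝒜 k v → In𝒜 k w → In𝒜 k (v · w)
    In𝒜-· v w (a , dimA , p) (b , dimB , q) =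
      a · b , All-DimLE-· dimA dimB , ≋⇒≈ᵥ (·-cong (≈ᵥ⇒≋ {v} {a} p) (≈ᵥ⇒≋ {w} {b} q))

    In𝒜-φ : ∀ a → In𝒜 k (φ k a)
    In𝒜-φ a = φ k a , map⁺ (universal (λ t → DimLE-skelᶜ k (proj₂ t)) a) , λ _ _ → ≈-refl

    All-DimLE-Δ : ∀ {w} → All (DimLE k ∘ proj₂) w →
                  All (λ t → DimLE k (proj₁ (proj₂ t)) × DimLE k (proj₂ (proj₂ t))) (Δ w)
    All-DimLE-Δ {[]}              []           = []
    All-DimLE-Δ {(r , n , Γ) ∷ w} (dim ∷ dims) =
      ++⁺ (map⁺ (map⁺ (universal (λ T → DimLE-restrict k Γ T dim , DimLE-restrict k Γ (∁ T) dim)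
                                 (allSubsets n))))
          (All-DimLE-Δ dims)

    In𝒜⊗-Δ : ∀ a → In𝒜 k a → In𝒜⊗ k (Δ a)
    In𝒜⊗-Δ a (w , dim , a≈w) = Δ w , All-DimLE-Δ dim , λ f inv → begin
      eval⊗ f (Δ a)       ≈⟨ eval⊗-Δ f a ⟩
      eval (evalΔᶜ f) a   ≈⟨ a≈w (evalΔᶜ f) (λ {A} {B} → evalΔᶜ-invariant f inv {A} {B}) ⟩
      eval (evalΔᶜ f) w   ≈⟨ eval⊗-Δ f w ⟨
      eval⊗ f (Δ w)       ∎
      where open ≈-Reasoning

    φ⊗φ-Δ : ∀ a → φ⊗φ k (Δ a) ≈⊗ Δ (φ k a)
    φ⊗φ-Δ a f inv = begin
      eval⊗ f (φ⊗φ k (Δ a))             ≡⟨ ∑-map (term⊗ f) _ (Δ a) ⟩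
      eval⊗ fₖ (Δ a)                    ≈⟨ eval⊗-Δ fₖ a ⟩
      eval (evalΔᶜ fₖ) a                ≈⟨ eval-cong skeleton-commutes a ⟩
      eval (evalΔᶜ f ∘ skelᶜ k) a       ≡⟨ φ-eval (evalΔᶜ f) a ⟨
      eval (evalΔᶜ f) (φ k a)           ≈⟨ eval⊗-Δ f (φ k a) ⟨
      eval⊗ f (Δ (φ k a))               ∎
      where
      open ≈-Reasoning
      fₖ : Cx → Cx → Carrier
      fₖ A B = f (skelᶜ k A) (skelᶜ k B)
      skeleton-commutes : ∀ A → evalΔᶜ fₖ A ≈ evalΔᶜ f (skelᶜ k A)
      skeleton-commutes (n , Γ) = ∑ˢ-cong n λ T →
        inv {skelᶜ k (restrictᶜ Γ T)} {restrictᶜ Γₖ T}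
            {skelᶜ k (restrictᶜ Γ (∁ T))} {restrictᶜ Γₖ (∁ T)}
            (skelᶜ-restrictᶜ k Γ T) (skelᶜ-restrictᶜ k Γ (∁ T))
        where
        Γₖ : Complex n
        Γₖ = skeleton k Γ

    module Antipode (S : Cx → V) (isAntipode : IsAntipode S) where
      open IsAntipode isAntipode

      S-cong : ∀ {A B} → A ≅ B → S A ≋ S B
      S-cong {A} {B} I = ≈ᵥ⇒≋ (well-defined {A} {B} I)

      summand : ∀ {n} → Complex n → Subset n → V
      summand Γ T = S (restrictᶜ Γ T) · ⟦ restrictᶜ Γ (∁ T) ⟧

      summand-full : ∀ {n} (Γ : Complex n) F → (∀ j → F j ≡ true) → summand Γ F ≋ S (n , Γ)
      summand-full Γ F full = ≋.trans
        (·-identityʳ (S (restrictᶜ Γ F)) (restrict Γ (∁ F)) (∣∁∣≡0 F full))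
        (S-cong (restrict-full-≅ Γ F full))

      antipode-recursion : ∀ {n} (Γ : Complex n) {L F} →
        allSubsets n ≡ L ++ F ∷ [] → (∀ j → F j ≡ true) →
        S (n , Γ) ≋ scale (εᶜ (n , Γ)) 𝟏 ++ scale (- 1#) (concatMap (summand Γ) L)
      antipode-recursion {n} Γ {L} {F} split full =
        ≋.trans (≋.sym (summand-full Γ F full)) (u++w≋e⇒w≋e-u law)
        where
        open ≋-Reasoning
        law : concatMap (summand Γ) L ++ summand Γ F ≋ scale (εᶜ (n , Γ)) 𝟏
        law = begin
          concatMap (summand Γ) L ++ summand Γ F
            ≡⟨ cong (concatMap (summand Γ) L ++_) (++-identityʳ (summand Γ F)) ⟨
          concatMap (summand Γ) L ++ concatMap (summand Γ) (F ∷ [])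
            ≡⟨ concatMap-++ (summand Γ) L (F ∷ []) ⟨
          concatMap (summand Γ) (L ++ F ∷ [])
            ≡⟨ cong (concatMap (summand Γ)) split ⟨
          concatMap (summand Γ) (allSubsets n)
            ≡⟨ concatMap-map (λ p → S (proj₁ p) · ⟦ proj₂ p ⟧) _ (allSubsets n) ⟨
          concatMap (λ p → S (proj₁ p) · ⟦ proj₂ p ⟧) (Δᶜ (n , Γ))
            ≈⟨ ≈ᵥ⇒≋ (left (n , Γ)) ⟩
          scale (εᶜ (n , Γ)) 𝟏 ∎

      In𝒜-S : ∀ A → DimLE k A → In𝒜 k (S A)
      In𝒜-S (n , Γ) = <-rec (λ n → ∀ Γ → DimLE k (n , Γ) → In𝒜 k (S (n , Γ))) step n Γ
        where
        step : ∀ n → (∀ {m} → m < n → ∀ Γ → DimLE k (m , Γ) → In𝒜 k (S (m , Γ))) →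
               ∀ Γ → DimLE k (n , Γ) → In𝒜 k (S (n , Γ))
        step n IH Γ dim with allSubsets-split n
        ... | L , F , split , full , proper =
          In𝒜-resp (antipode-recursion Γ split full)
            (In𝒜-++ (scale εΓ 𝟏) (scale (- 1#) (concatMap (summand Γ) L))
              (In𝒜-scale εΓ 𝟏 (In𝒜-⟦⟧ 𝟙ᶜ (DimLE-𝟙ᶜ k)))
              (In𝒜-scale (- 1#) (concatMap (summand Γ) L)
                (In𝒜-concatMap (summand Γ) L (All.map In𝒜-summand proper))))
          where
          εΓ : Carrier
          εΓ = εᶜ (n , Γ)
          In𝒜-summand : ∀ {T} → ∣ T ∣ < n → In𝒜 k (summand Γ T)
          In𝒜-summand {T} ∣T∣<n =
            In𝒜-· (S (restrictᶜ Γ T)) ⟦ restrictᶜ Γ (∁ T) ⟧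
              (IH ∣T∣<n (restrict Γ T) (DimLE-restrict k Γ T dim))
              (In𝒜-⟦⟧ (restrictᶜ Γ (∁ T)) (DimLE-restrict k Γ (∁ T) dim))

      φ-S : ∀ A → φ k (S A) ≋ S (skelᶜ k A)
      φ-S (n , Γ) = <-rec (λ n → ∀ Γ → φ k (S (n , Γ)) ≋ S (n , skeleton k Γ)) step n Γ
        where
        step : ∀ n → (∀ {m} → m < n → ∀ Γ → φ k (S (m , Γ)) ≋ S (m , skeleton k Γ)) →
               ∀ Γ → φ k (S (n , Γ)) ≋ S (n , skeleton k Γ)
        step n IH Γ with allSubsets-split n
        ... | L , F , split , full , proper = begin
          φ k (S (n , Γ))
            ≈⟨ φ-cong (antipode-recursion Γ split full) ⟩
          φ k (scale (εᶜ (n , Γ)) 𝟏 ++ scale (- 1#) (concatMap (summand Γ) L))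
            ≡⟨ φ-linear ⟩
          scale (εᶜ (n , Γ)) (φ k 𝟏) ++ scale (- 1#) (concatMap (φ k ∘ summand Γ) L)
            ≈⟨ ++-cong (scale-cong (≈-sym (εᶜ-skelᶜ (n , Γ))) φ-𝟏)
                       (scale-cong ≈-refl (concatMap-cong L (All.map φ-summand proper))) ⟩
          scale (εᶜ (n , Γₖ)) 𝟏 ++ scale (- 1#) (concatMap (summand Γₖ) L)
            ≈⟨ antipode-recursion Γₖ split full ⟨
          S (n , Γₖ) ∎
          where
          open ≋-Reasoning
          Γₖ : Complex n
          Γₖ = skeleton k Γ
          φ-linear : φ k (scale (εᶜ (n , Γ)) 𝟏 ++ scale (- 1#) (concatMap (summand Γ) L)) ≡
                     scale (εᶜ (n , Γ)) (φ k 𝟏) ++ scale (- 1#) (concatMap (φ k ∘ summand Γ) L)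
          φ-linear = trans (φ-++ (scale (εᶜ (n , Γ)) 𝟏) _)
            (cong (scale (εᶜ (n , Γ)) (φ k 𝟏) ++_)
              (trans (φ-scale (- 1#) _) (cong (scale (- 1#)) (φ-concatMap (summand Γ) L))))
          φ-summand : ∀ {T} → ∣ T ∣ < n → φ k (summand Γ T) ≋ summand Γₖ T
          φ-summand {T} ∣T∣<n = begin
            φ k (summand Γ T)
              ≈⟨ φ-· (S (restrictᶜ Γ T)) ⟦ restrictᶜ Γ (∁ T) ⟧ ⟩
            φ k (S (restrictᶜ Γ T)) · ⟦ skelᶜ k (restrictᶜ Γ (∁ T)) ⟧
              ≈⟨ ·-cong (IH ∣T∣<n (restrict Γ T)) ≋.refl ⟩
            S (skelᶜ k (restrictᶜ Γ T)) · ⟦ skelᶜ k (restrictᶜ Γ (∁ T)) ⟧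
              ≈⟨ ·-cong (S-cong (skelᶜ-restrictᶜ k Γ T)) (⟦⟧-cong (skelᶜ-restrictᶜ k Γ (∁ T))) ⟩
            summand Γₖ T ∎

      lin-cong : ∀ {a b} → a ≋ b → lin S a ≋ lin S b
      lin-cong {a} {b} (≈ᵥ⇒≋ p) = ≈ᵥ⇒≋ λ f inv → begin
        eval f (lin S a)             ≈⟨ eval-lin f S a ⟩
        eval (λ A → eval f (S A)) a  ≈⟨ p _ (λ {A} {B} I → ≋⇒≈ᵥ (S-cong I) f inv) ⟩
        eval (λ A → eval f (S A)) b  ≈⟨ eval-lin f S b ⟨
        eval f (lin S b)             ∎
        where open ≈-Reasoning

      In𝒜-lin : ∀ a → In𝒜 k a → In𝒜 k (lin S a)
      In𝒜-lin a (w , dim , a≈w) = In𝒜-resp (lin-cong (≈ᵥ⇒≋ {a} {w} a≈w))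
        (In𝒜-concatMap (λ t → scale (proj₁ t) (S (proj₂ t))) w
          (All.map (λ {t} d → In𝒜-scale (proj₁ t) (S (proj₂ t)) (In𝒜-S (proj₂ t) d)) dim))

      φ-lin : ∀ a → φ k (lin S a) ≋ lin S (φ k a)
      φ-lin a = ≈ᵥ⇒≋ λ f inv → begin
        eval f (φ k (lin S a))                    ≡⟨ φ-eval f (lin S a) ⟩
        eval (f ∘ skelᶜ k) (lin S a)              ≈⟨ eval-lin (f ∘ skelᶜ k) S a ⟩
        eval (λ A → eval (f ∘ skelᶜ k) (S A)) a
          ≈⟨ eval-cong (λ A → ≈-trans (≈-reflexive (sym (φ-eval f (S A))))
                                      (≋⇒≈ᵥ (φ-S A) f inv)) a ⟩
        eval (λ A → eval f (S (skelᶜ k A))) a     ≡⟨ φ-eval (λ A → eval f (S A)) a ⟨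
        eval (λ A → eval f (S A)) (φ k a)         ≈⟨ eval-lin f S (φ k a) ⟨
        eval f (lin S (φ k a))                    ∎
        where open ≈-Reasoning

proposition3p2 : ∀ {c ℓ : Level} (K : Field c ℓ) (k : ℕ) → let open Space K in
    In𝒜 k 𝟏
    × (∀ a b → In𝒜 k a → In𝒜 k b → In𝒜 k (a · b))
    × (∀ a → In𝒜 k a → In𝒜⊗ k (Δ a))
    × (∀ S → IsAntipode S → ∀ a → In𝒜 k a → In𝒜 k (lin S a))
    × (∀ a b → a ≈ᵥ b → φ k a ≈ᵥ φ k b)
    × (∀ a → In𝒜 k (φ k a))
    × (∀ a b → φ k (a · b) ≈ᵥ φ k a · φ k b)
    × (φ k 𝟏 ≈ᵥ 𝟏)
    × (∀ a → φ⊗φ k (Δ a) ≈⊗ Δ (φ k a))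
    × (∀ a → ε (φ k a) ≈ ε a)
    × (∀ S → IsAntipode S → ∀ a → φ k (lin S a) ≈ᵥ lin S (φ k a))
proposition3p2 K k =
  In𝒜-⟦⟧ 𝟙ᶜ (DimLE-𝟙ᶜ k) ,
  In𝒜-· ,
  In𝒜⊗-Δ ,
  In𝒜-lin ,
  (λ a b a≈b → ≋⇒≈ᵥ (φ-cong (≈ᵥ⇒≋ {a} {b} a≈b))) ,
  In𝒜-φ ,
  (λ a b → ≋⇒≈ᵥ (φ-· a b)) ,
  ≋⇒≈ᵥ φ-𝟏 ,
  φ⊗φ-Δ ,
  ε-φ ,
  (λ S isAntipode a → ≋⇒≈ᵥ (φ-lin S isAntipode a))
  where
  open LinearCombinations K
  open Skeletons k
  open Antipode
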